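{- For any finite graph $G$, $$F_{wi}(G)\leq a(G)\leq F(G).$$
   Context: $F(G)$ is the number of forests of $G$ (edge subsets with no cycle), $a(G)$ is the number of acyclic orientations of $G$. A set $S\subseteq E(G)$ is a weakly induced forest if it contains no cycle and, for each connected component of the spanning subgraph $(V(G),S)$, every edge of $G$ with both endpoints in that component belongs to $S$ (all other edges of $G$ go between different components). $F_{wi}(G)$ is the number of weakly induced forests of $G$. -}

module Defs where

open import Data.Nat using (ℕ; _≤_)
open import Data.Bool using (Bool; true; false; _∧_; if_then_else_)
open import Data.Fin using (Fin; toℕ; _<?_)
open import Data.List using (List; []; _∷_; [_]; _++_; length; filter; concatMap; allFin)
open import Data.List.Membership.Propositional using (_∈_; _∉_)
open import Data.List.Relation.Unary.Unique.Propositional using (Unique)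
open import Data.List.Relation.Unary.Linked using (Linked)
open import Data.Product using (_×_; _,_; ∃)
open import Data.Sum using (_⊎_)
open import Relation.Nullary using (¬_; ⌊_⌋)
open import Relation.Unary using (Decidable)
open import Relation.Binary.PropositionalEquality using (_≡_)
open import Relation.Binary.Construct.Closure.ReflexiveTransitive using (Star)

record SimpleGraph (n : ℕ) : Set where
  field
    adj    : Fin n → Fin n → Bool
    sym    : ∀ u v → adj u v ≡ adj v u
    irrefl : ∀ v → adj v v ≡ false
open SimpleGraph public

Edge : ℕ → Set
Edge n = Fin n × Fin n

-- The edge set E(G): each edge {i,j} listed once, as the pair (i , j) with i < j.
edges : ∀ {n} → SimpleGraph n → List (Edge n)
edges {n} G = concatMap (λ i → concatMap (λ j →
  if ⌊ i <? j ⌋ ∧ adj G i j then [ (i , j) ] else []) (allFin n)) (allFin n)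

-- All sublists (= all subsets, since edges G has no repetitions).
sublists : ∀ {A : Set} → List A → List (List A)
sublists [] = [ [] ]
sublists (x ∷ xs) = let r = sublists xs in Data.List.map (x ∷_) r ++ r
  where import Data.List

SAdj : ∀ {n} → List (Edge n) → Fin n → Fin n → Set
SAdj S u v = ((u , v) ∈ S) ⊎ ((v , u) ∈ S)

HasCycle : ∀ {n} → (Fin n → Fin n → Set) → Set
HasCycle R = ∃ λ v → ∃ λ ws → 2 ≤ length ws × Unique (v ∷ ws) × Linked R (v ∷ ws ++ [ v ])

IsForest : ∀ {n} → SimpleGraph n → List (Edge n) → Set
IsForest G S = ¬ HasCycle (SAdj S)

SameComp : ∀ {n} → List (Edge n) → Fin n → Fin n → Set
SameComp S = Star (SAdj S)

IsWIForest : ∀ {n} → SimpleGraph n → List (Edge n) → Set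
IsWIForest G S = IsForest G S
  × (∀ u v → (u , v) ∈ edges G → SameComp S u v → (u , v) ∈ S)

-- An orientation of G is encoded by the set O ⊆ E(G) of edges (i , j), i < j,
-- oriented i → j; the remaining edges are oriented j → i.
Arc : ∀ {n} → SimpleGraph n → List (Edge n) → Fin n → Fin n → Set
Arc G O u v = ((u , v) ∈ edges G × (u , v) ∈ O) ⊎ ((v , u) ∈ edges G × (v , u) ∉ O)

IsAcyclicOrientation : ∀ {n} → SimpleGraph n → List (Edge n) → Set
IsAcyclicOrientation G O = ¬ (∃ λ v → ∃ λ ws → Linked (Arc G O) (v ∷ ws ++ [ v ]))

-- Counting: the result does not depend on which decision procedure is supplied.
count : ∀ {A : Set} {P : A → Set} → Decidable P → List A → ℕ
count P? xs = length (filter P? xs)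

numForests : ∀ {n} (G : SimpleGraph n) → Decidable (IsForest G) → ℕ
numForests G d = count d (sublists (edges G))

numWIForests : ∀ {n} (G : SimpleGraph n) → Decidable (IsWIForest G) → ℕ
numWIForests G d = count d (sublists (edges G))

numAcyclicOrientations : ∀ {n} (G : SimpleGraph n) → Decidable (IsAcyclicOrientation G) → ℕ
numAcyclicOrientations G d = count d (sublists (edges G))

module Submission where

-- The inequalities F_wi(G) ≤ a(G) ≤ F(G) are proved by deletion/contraction on
-- a "partially contracted" graph: a list K of edges that are declared contracted
-- together with a list L of edges still to be decided.  For such a pair we count
--   forests       : S ⊆ L with S ∪ K a forest,
--   orientations  : orientations of L that are acyclic after contracting K
--                   (no arc x → y with a way back from y to x using arcs and K),
--   wi-forests    : S ⊆ L with S ∪ K a forest such that every edge of L inside a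
--                   component of S ∪ K lies in S.
-- Picking the first edge e = uv of L, deleting it (L' = L - e) and contracting it
-- (K' = e ∷ K) gives the recurrences
--   forests K L = forests K L' + forests K' L',
--   orientations K L ≤ orientations K L' + orientations K' L'
--                    ≤ orientations K L   when u, v are not joined by K,
--   wi-forests K L ≤ wi-forests K L' + wi-forests K' L',
-- while orientations and wi-forests vanish when K already joins u and v.
-- Induction on L then yields wi-forests ≤ orientations ≤ forests, and the theorem
-- is the case K = [], L = E(G).  The upper bound needs K to stay a forest; the
-- lower bound needs that no edge of L is parallel to an edge of K, which holds
-- because E(G) lists every edge once, as an ordered pair.

open import Level using (0ℓ)
open import Data.Nat using (ℕ; zero; suc; _+_; _≤_; _<_; z≤n; s≤s)
open import Data.Nat.Properties
  using (≤-refl; ≤-reflexive; ≤-trans; ≤-antisym; +-mono-≤; +-comm; <-irrefl; <-asym; n≤1+n;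
         +-commutativeSemigroup; module ≤-Reasoning)
open import Algebra.Properties.CommutativeSemigroup +-commutativeSemigroup using (interchange)
open import Data.Bool using (true; false; _∧_; if_then_else_)
open import Data.Fin using (Fin; zero; suc; toℕ; _<?_; _≟_)
open import Data.Fin.Properties using (any?; injective⇒≤)
open import Data.List using (List; []; _∷_; [_]; _++_; length; lookup; map; filter; concatMap; allFin)
open import Data.List.Properties using (length-++; filter-++; ++-assoc; ++-identityʳ)
open import Data.List.Membership.Propositional using (_∈_; _∉_; find)
open import Data.List.Membership.Propositional.Properties
  using (∈-lookup; ∈-++⁻; ∈-++⁺ˡ; ∈-++⁺ʳ; ∈-map⁻; ∈-∃++; ∈-concatMap⁻)
open import Data.List.Relation.Unary.Any using (here; there)
open import Data.List.Relation.Unary.All as All using (All; []; _∷_; all?)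
open import Data.List.Relation.Unary.All.Properties.Core using (¬Any⇒All¬)
open import Data.List.Relation.Unary.AllPairs using ([]; _∷_)
open import Data.List.Relation.Unary.Linked as Linked using (Linked; []; [-]; _∷_)
open import Data.List.Relation.Unary.Unique.Propositional using (Unique)
open import Data.List.Relation.Unary.Unique.Propositional.Properties
  using (Unique[x∷xs]⇒x∉xs; ++⁺; allFin⁺)
open import Data.Product using (Σ; _×_; _,_; proj₁; proj₂)
open import Data.Sum using (_⊎_; inj₁; inj₂) renaming (map to ⊎-map)
open import Data.Empty using (⊥; ⊥-elim)
open import Function using (_∘_; id)
open import Relation.Nullary using (¬_; Dec; yes; no; ⌊_⌋)
open import Relation.Nullary.Decidable using (_⊎-dec_; _×-dec_; _→-dec_; ¬?; map′)
open import Relation.Unary using (Decidable)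
open import Relation.Binary.Core using (Rel; _⇒_; _⇔_)
open import Relation.Binary.Definitions using (Symmetric) renaming (Decidable to Decidable₂)
open import Relation.Binary.PropositionalEquality using (_≡_; refl; sym; trans; cong; cong₂; subst; module ≡-Reasoning)
open import Relation.Binary.Construct.Closure.ReflexiveTransitive as Star using (Star; ε; _◅_; _◅◅_)
open import Relation.Binary.Construct.Union using (_∪_)
open import Data.List.Relation.Binary.Permutation.Propositional using (_↭_; ↭-sym)
open import Data.List.Relation.Binary.Permutation.Propositional.Properties using (shift; ∈-resp-↭)

open import Defs hiding (sym)

private
  variable
    A B : Set

-- Counting over sublists

𝟙 : {P : Set} → Dec P → ℕ
𝟙 (yes _) = 1
𝟙 (no _)  = 0

count-∷ : {P : A → Set} (P? : Decidable P) (x : A) (xs : List A) →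
          count P? (x ∷ xs) ≡ 𝟙 (P? x) + count P? xs
count-∷ P? x xs with P? x
... | yes _ = refl
... | no _  = refl

count-++ : {P : A → Set} (P? : Decidable P) (xs ys : List A) →
           count P? (xs ++ ys) ≡ count P? xs + count P? ys
count-++ P? xs ys = trans (cong length (filter-++ P? xs ys)) (length-++ (filter P? xs))

count-map : {P : A → Set} (P? : Decidable P) (f : B → A) (xs : List B) →
            count P? (map f xs) ≡ count (λ y → P? (f y)) xs
count-map P? f []       = refl
count-map P? f (x ∷ xs) = begin
  count P? (f x ∷ map f xs)                ≡⟨ count-∷ P? (f x) (map f xs) ⟩
  𝟙 (P? (f x)) + count P? (map f xs)       ≡⟨ cong (𝟙 (P? (f x)) +_) (count-map P? f xs) ⟩
  𝟙 (P? (f x)) + count (λ y → P? (f y)) xs ≡⟨ sym (count-∷ (λ y → P? (f y)) x xs) ⟩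
  count (λ y → P? (f y)) (x ∷ xs)          ∎
  where open ≡-Reasoning

count-mono : {P Q : A → Set} (P? : Decidable P) (Q? : Decidable Q) (xs : List A) →
             (∀ x → x ∈ xs → P x → Q x) → count P? xs ≤ count Q? xs
count-mono P? Q? []       h = z≤n
count-mono P? Q? (x ∷ xs) h
  rewrite count-∷ P? x xs | count-∷ Q? x xs =
  +-mono-≤ (indicator-mono (P? x) (Q? x) (h x (here refl)))
           (count-mono P? Q? xs (λ y m → h y (there m)))
  where
  indicator-mono : {P Q : Set} (p : Dec P) (q : Dec Q) → (P → Q) → 𝟙 p ≤ 𝟙 q
  indicator-mono (yes p) (yes q) f = ≤-refl
  indicator-mono (yes p) (no ¬q) f = ⊥-elim (¬q (f p))
  indicator-mono (no ¬p) q       f = z≤n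

count-cong : {P Q : A → Set} (P? : Decidable P) (Q? : Decidable Q) (xs : List A) →
             (∀ x → x ∈ xs → P x → Q x) → (∀ x → x ∈ xs → Q x → P x) →
             count P? xs ≡ count Q? xs
count-cong P? Q? xs f g = ≤-antisym (count-mono P? Q? xs f) (count-mono Q? P? xs g)

count-none : {P : A → Set} (P? : Decidable P) (xs : List A) →
             (∀ x → x ∈ xs → ¬ P x) → count P? xs ≡ 0
count-none P? []       h = refl
count-none P? (x ∷ xs) h with P? x
... | yes p = ⊥-elim (h x (here refl) p)
... | no _  = count-none P? xs (λ y m → h y (there m))

count-pair-mono : {P₁ P₂ Q₁ Q₂ : A → Set}
  (P₁? : Decidable P₁) (P₂? : Decidable P₂) (Q₁? : Decidable Q₁) (Q₂? : Decidable Q₂) (xs : List A) →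
  (∀ x → x ∈ xs → 𝟙 (P₁? x) + 𝟙 (P₂? x) ≤ 𝟙 (Q₁? x) + 𝟙 (Q₂? x)) →
  count P₁? xs + count P₂? xs ≤ count Q₁? xs + count Q₂? xs
count-pair-mono P₁? P₂? Q₁? Q₂? []       h = z≤n
count-pair-mono P₁? P₂? Q₁? Q₂? (x ∷ xs) h
  rewrite count-∷ P₁? x xs | count-∷ P₂? x xs | count-∷ Q₁? x xs | count-∷ Q₂? x xs
        | interchange (𝟙 (P₁? x)) (count P₁? xs) (𝟙 (P₂? x)) (count P₂? xs)
        | interchange (𝟙 (Q₁? x)) (count Q₁? xs) (𝟙 (Q₂? x)) (count Q₂? xs) =
  +-mono-≤ (h x (here refl)) (count-pair-mono P₁? P₂? Q₁? Q₂? xs (λ y m → h y (there m)))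

-- The indicator inequality behind "a(G) ≤ a(G - e) + a(G / e)": each of P₁, P₂
-- implies Q₁, and together they imply Q₂.
𝟙-pair-≤ : {P₁ P₂ Q₁ Q₂ : Set} (p₁ : Dec P₁) (p₂ : Dec P₂) (q₁ : Dec Q₁) (q₂ : Dec Q₂) →
           (P₁ → Q₁) → (P₂ → Q₁) → (P₁ → P₂ → Q₂) → 𝟙 p₁ + 𝟙 p₂ ≤ 𝟙 q₁ + 𝟙 q₂
𝟙-pair-≤ (no _)  (no _)  _       _       _ _ _ = z≤n
𝟙-pair-≤ (yes _) (no _)  (yes _) _       _ _ _ = s≤s z≤n
𝟙-pair-≤ (yes a) (no _)  (no ¬c) _       f _ _ = ⊥-elim (¬c (f a))
𝟙-pair-≤ (no _)  (yes _) (yes _) _       _ _ _ = s≤s z≤n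
𝟙-pair-≤ (no _)  (yes b) (no ¬c) _       _ g _ = ⊥-elim (¬c (g b))
𝟙-pair-≤ (yes _) (yes _) (yes _) (yes _) _ _ _ = ≤-refl
𝟙-pair-≤ (yes a) (yes _) (no ¬c) _       f _ _ = ⊥-elim (¬c (f a))
𝟙-pair-≤ (yes a) (yes b) (yes _) (no ¬d) _ _ h = ⊥-elim (¬d (h a b))

-- The indicator inequality behind "a(G - e) + a(G / e) ≤ a(G)": Q₁ together
-- with ¬ P₁ gives P₂, and Q₂ gives both P₁ and P₂.
𝟙-pair-≥ : {P₁ P₂ Q₁ Q₂ : Set} (p₁ : Dec P₁) (p₂ : Dec P₂) (q₁ : Dec Q₁) (q₂ : Dec Q₂) →
           (Q₁ → ¬ P₁ → P₂) → (Q₂ → P₁) → (Q₂ → P₂) → 𝟙 q₁ + 𝟙 q₂ ≤ 𝟙 p₁ + 𝟙 p₂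
𝟙-pair-≥ _       _       (no _)  (no _)  _ _ _ = z≤n
𝟙-pair-≥ (yes _) _       (yes _) (no _)  _ _ _ = s≤s z≤n
𝟙-pair-≥ (no _)  (yes _) (yes _) (no _)  _ _ _ = s≤s z≤n
𝟙-pair-≥ (no ¬a) (no ¬b) (yes c) (no _)  f _ _ = ⊥-elim (¬b (f c ¬a))
𝟙-pair-≥ (no ¬a) _       _       (yes d) _ g _ = ⊥-elim (¬a (g d))
𝟙-pair-≥ (yes _) (no ¬b) _       (yes d) _ _ h = ⊥-elim (¬b (h d))
𝟙-pair-≥ (yes _) (yes _) (yes _) (yes _) _ _ _ = ≤-refl
𝟙-pair-≥ (yes _) (yes _) (no _)  (yes _) _ _ _ = s≤s z≤n

sublist-⊆ : {S L : List A} → S ∈ sublists L → ∀ {x} → x ∈ S → x ∈ L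
sublist-⊆ {L = []} (here refl) ()
sublist-⊆ {L = y ∷ L} m x∈S with ∈-++⁻ (map (y ∷_) (sublists L)) m
... | inj₂ m′ = there (sublist-⊆ m′ x∈S)
... | inj₁ m′ with ∈-map⁻ (y ∷_) m′
...   | S′ , m″ , refl with x∈S
...     | here refl = here refl
...     | there x∈S′ = there (sublist-⊆ m″ x∈S′)

count-sublists-∷ : {P : List A → Set} (P? : Decidable P) (e : A) (L : List A) →
  count P? (sublists (e ∷ L)) ≡ count (λ σ → P? (e ∷ σ)) (sublists L) + count P? (sublists L)
count-sublists-∷ P? e L =
  trans (count-++ P? (map (e ∷_) (sublists L)) (sublists L))
        (cong (_+ count P? (sublists L)) (count-map P? (e ∷_) (sublists L)))

-- Reachability on a finite vertex set

FinRel : ℕ → Set₁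
FinRel n = Rel (Fin n) 0ℓ

unique-length : ∀ {n} {xs : List (Fin n)} → Unique xs → length xs ≤ n
unique-length u = injective⇒≤ (lookup-injective u)
  where
  lookup-injective : ∀ {n} {xs : List (Fin n)} → Unique xs →
                     ∀ {i j} → lookup xs i ≡ lookup xs j → i ≡ j
  lookup-injective {xs = x ∷ xs} (x∉ ∷ u) {zero}  {zero}  e = refl
  lookup-injective {xs = x ∷ xs} (x∉ ∷ u) {zero}  {suc j} e = ⊥-elim (All.lookup x∉ (∈-lookup j) e)
  lookup-injective {xs = x ∷ xs} (x∉ ∷ u) {suc i} {zero}  e = ⊥-elim (All.lookup x∉ (∈-lookup i) (sym e))
  lookup-injective {xs = x ∷ xs} (x∉ ∷ u) {suc i} {suc j} e = cong suc (lookup-injective u e)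

module Reachability {n : ℕ} {R : FinRel n} where

  -- The vertices a path visits, in order, without its endpoint.
  vertices : ∀ {x y} → Star R x y → List (Fin n)
  vertices ε = []
  vertices {x = x} (_ ◅ s) = x ∷ vertices s

  open import Data.List.Membership.DecPropositional (_≟_ {n}) using (_∈?_)

  simple-suffix : ∀ {x y z} (t : Star R z y) → x ∈ vertices t → Unique (y ∷ vertices t) →
                  Σ (Star R x y) λ t′ → Unique (y ∷ vertices t′)
  simple-suffix (r ◅ t) (here refl) u = (r ◅ t) , u
  simple-suffix (r ◅ t) (there x∈t) ((_ ∷ y∉) ∷ (_ ∷ u)) = simple-suffix t x∈t (y∉ ∷ u)

  -- Every path contains a simple path between the same endpoints: cut out the
  -- detour between two visits of the same vertex.
  simple-path : ∀ {x y} → Star R x y → Σ (Star R x y) λ t → Unique (y ∷ vertices t)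
  simple-path ε = ε , [] ∷ []
  simple-path {x} {y} (r ◅ s) with simple-path s
  ... | t , t-simple with x ≟ y
  ...   | yes refl = ε , [] ∷ []
  ...   | no x≢y with x ∈? vertices t
  ...     | yes x∈t = simple-suffix t x∈t t-simple
  ...     | no x∉t with t-simple
  ...       | y∉t ∷ t-unique =
    (r ◅ t) , ((λ y≡x → x≢y (sym y≡x)) ∷ y∉t) ∷ (¬Any⇒All¬ _ x∉t ∷ t-unique)

  Within : ℕ → FinRel n
  Within zero    x y = x ≡ y
  Within (suc k) x y = x ≡ y ⊎ Σ (Fin n) λ z → R x z × Within k z y

  within? : Decidable₂ R → ∀ k → Decidable₂ (Within k)
  within? R? zero    x y = x ≟ y
  within? R? (suc k) x y = (x ≟ y) ⊎-dec any? (λ z → R? x z ×-dec within? R? k z y)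

  path→within : ∀ k {x y} (s : Star R x y) → length (vertices s) ≤ k → Within k x y
  path→within zero    ε       _         = refl
  path→within (suc k) ε       _         = inj₁ refl
  path→within (suc k) (r ◅ s) (s≤s len) = inj₂ (_ , r , path→within k s len)

  within→path : ∀ k {x y} → Within k x y → Star R x y
  within→path zero    refl                = ε
  within→path (suc k) (inj₁ refl)         = ε
  within→path (suc k) (inj₂ (z , r , w)) = r ◅ within→path k w

  -- Reachability is decidable: a simple path has fewer than n steps.
  star? : Decidable₂ R → Decidable₂ (Star R)
  star? R? x y = map′ (within→path n) reach (within? R? n x y)
    where
    reach : Star R x y → Within n x y
    reach s with simple-path s
    ... | t , t-simple = path→within n t (≤-trans (n≤1+n _) (unique-length t-simple))

open Reachability public

-- Cycles of a relation

arc : ∀ {n} → Fin n → Fin n → FinRel n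
arc u v x y = x ≡ u × y ≡ v

link : ∀ {n} → Fin n → Fin n → FinRel n
link u v = arc u v ∪ arc v u

module Cycles {n : ℕ} where
  open import Data.List.Membership.DecPropositional (_≟_ {n}) using (_∈?_)
  open import Data.List.Relation.Binary.Permutation.Propositional using (↭⇒↭ₛ; prep) renaming (trans to ↭-trans)
  open import Data.List.Relation.Binary.Permutation.Propositional.Properties using (++-comm; ↭-length)
  open import Relation.Binary.PropositionalEquality.Properties using (setoid)
  open import Data.List.Relation.Binary.Permutation.Setoid.Properties (setoid (Fin n)) using (Unique-resp-↭)
  open import Data.Nat.Properties using (suc-injective)

  private variable
    R R′ : FinRel n
    a b u v z : Fin n

  cycle-mono : R ⇒ R′ → HasCycle R → HasCycle R′
  cycle-mono f (v , ws , long , distinct , walk) = v , ws , long , distinct , Linked.map f walk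

  walk→path : ∀ ws → Linked R (a ∷ ws ++ [ b ]) → Star R a b
  walk→path []       (r ∷ [-])  = r ◅ ε
  walk→path (w ∷ ws) (r ∷ walk) = r ◅ walk→path ws walk

  path→walk : R ⇒ R′ → (t : Star R a b) → R′ z a → Linked R′ (z ∷ vertices t ++ [ b ])
  path→walk f ε       r = r ∷ [-]
  path→walk f (s ◅ t) r = r ∷ path→walk f t (f s)

  simple-path-cycle : R ⇒ R′ → (t : Star R a b) → Unique (b ∷ vertices t) →
                      2 ≤ length (vertices t) → R′ b a → HasCycle R′
  simple-path-cycle f t distinct long r = _ , vertices t , long , distinct , path→walk f t r

  avoid-link : ∀ xs → u ∉ xs → Linked (R ∪ link u v) xs → Linked R xs
  avoid-link []           _  []                               = []
  avoid-link (x ∷ [])     _  [-]                              = [-]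
  avoid-link (x ∷ y ∷ xs) u∉ (inj₁ r ∷ walk)                  = r ∷ avoid-link (y ∷ xs) (u∉ ∘ there) walk
  avoid-link (x ∷ y ∷ xs) u∉ (inj₂ (inj₁ (refl , _)) ∷ walk) = ⊥-elim (u∉ (here refl))
  avoid-link (x ∷ y ∷ xs) u∉ (inj₂ (inj₂ (_ , refl)) ∷ walk) = ⊥-elim (u∉ (there (here refl)))

  walk-split : ∀ xs {y} ys → Linked R (xs ++ y ∷ ys) → Linked R (xs ++ [ y ]) × Linked R (y ∷ ys)
  walk-split []           ys walk       = [-] , walk
  walk-split (x ∷ [])     ys (r ∷ walk) = (r ∷ [-]) , walk
  walk-split (x ∷ x′ ∷ xs) ys (r ∷ walk) with walk-split (x′ ∷ xs) ys walk
  ... | front , back = (r ∷ front) , back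

  walk-join : ∀ xs {y} ys → Linked R (xs ++ [ y ]) → Linked R (y ∷ ys) → Linked R (xs ++ y ∷ ys)
  walk-join []            ys front        back = back
  walk-join (x ∷ [])      ys (r ∷ _)     back = r ∷ back
  walk-join (x ∷ x′ ∷ xs) ys (r ∷ front) back = r ∷ walk-join (x′ ∷ xs) ys front back

  rotate-cycle : ∀ {R : FinRel n} {u x : Fin n} ws → u ∈ (x ∷ ws) → 2 ≤ length ws → Unique (x ∷ ws) →
    Linked R (x ∷ ws ++ [ x ]) →
    Σ (List (Fin n)) λ ws′ → 2 ≤ length ws′ × Unique (u ∷ ws′) × Linked R (u ∷ ws′ ++ [ u ])
  rotate-cycle {R = R} {u = u} ws u∈ long distinct walk with ∈-∃++ u∈
  ... | []     , B , refl = B , long , distinct , walk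
  ... | a ∷ A , B , refl =
    B ++ a ∷ A ,
    subst (2 ≤_) (suc-injective (↭-length rotation)) long ,
    Unique-resp-↭ (↭⇒↭ₛ rotation) distinct ,
    subst (λ zs → Linked R (u ∷ zs)) (sym (++-assoc B (a ∷ A) [ u ])) (walk-join (u ∷ B) (A ++ [ u ]) back front)
    where
    rotation : (a ∷ A ++ u ∷ B) ↭ (u ∷ B ++ a ∷ A)
    rotation = ↭-trans (shift u (a ∷ A) B) (prep u (++-comm (a ∷ A) B))
    split : Linked R (a ∷ A ++ [ u ]) × Linked R (u ∷ B ++ [ a ])
    split = walk-split (a ∷ A) (B ++ [ a ]) (subst (λ zs → Linked R (a ∷ zs)) (++-assoc A (u ∷ B) [ a ]) walk)
    front : Linked R (a ∷ A ++ [ u ])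
    front = proj₁ split
    back : Linked R (u ∷ B ++ [ a ])
    back = proj₂ split

  last : Fin n → List (Fin n) → Fin n
  last w []       = w
  last w (x ∷ xs) = last x xs

  last-∈ : ∀ w x xs → last w (x ∷ xs) ∈ (x ∷ xs)
  last-∈ w x []       = here refl
  last-∈ w x (y ∷ xs) = there (last-∈ x y xs)

  walk-into-u : ∀ w ws → u ∉ (w ∷ ws) → Linked (R ∪ link u v) (w ∷ ws ++ [ u ]) →
                Linked R (w ∷ ws ++ [ u ]) ⊎ (Star R w v × last w ws ≡ v)
  walk-into-u w []       u∉ (inj₁ r ∷ [-])                  = inj₁ (r ∷ [-])
  walk-into-u w []       u∉ (inj₂ (inj₁ (refl , _)) ∷ [-]) = ⊥-elim (u∉ (here refl))
  walk-into-u w []       u∉ (inj₂ (inj₂ (refl , _)) ∷ [-]) = inj₂ (ε , refl)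
  walk-into-u w (x ∷ xs) u∉ (inj₁ r ∷ walk) with walk-into-u x xs (u∉ ∘ there) walk
  ... | inj₁ walk′         = inj₁ (r ∷ walk′)
  ... | inj₂ (path , last≡v) = inj₂ (r ◅ path , last≡v)
  walk-into-u w (x ∷ xs) u∉ (inj₂ (inj₁ (refl , _)) ∷ walk) = ⊥-elim (u∉ (here refl))
  walk-into-u w (x ∷ xs) u∉ (inj₂ (inj₂ (_ , refl)) ∷ walk) = ⊥-elim (u∉ (there (here refl)))

  cycle-through : ∀ {R : FinRel n} {u v : Fin n} ws → 2 ≤ length ws → Unique (u ∷ ws) →
                  Linked (R ∪ link u v) (u ∷ ws ++ [ u ]) → HasCycle R ⊎ (Star R u v ⊎ Star R v u)
  cycle-through {R = R} {u = u} {v = v} (w ∷ ws) long distinct (first ∷ walk) =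
    cases first (walk-into-u w ws (Unique[x∷xs]⇒x∉xs distinct) walk)
    where
    cases : (R ∪ link u v) u w → Linked R (w ∷ ws ++ [ u ]) ⊎ (Star R w v × last w ws ≡ v) →
            HasCycle R ⊎ (Star R u v ⊎ Star R v u)
    cases (inj₁ r)                 (inj₁ walk′)        = inj₁ (u , w ∷ ws , long , distinct , r ∷ walk′)
    cases (inj₁ r)                 (inj₂ (path , _))   = inj₂ (inj₁ (r ◅ path))
    cases (inj₂ (inj₂ (_ , w≡u)))  _                   = ⊥-elim (Unique[x∷xs]⇒x∉xs distinct (here (sym w≡u)))
    cases (inj₂ (inj₁ (_ , refl))) (inj₁ walk′)       = inj₂ (inj₂ (walk→path ws walk′))
    cases (inj₂ (inj₁ (_ , refl))) (inj₂ (_ , last≡w)) = ⊥-elim (last-repeats ws long distinct last≡w)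
      where
      last-repeats : ∀ ws → 2 ≤ length (w ∷ ws) → Unique (u ∷ w ∷ ws) → last w ws ≡ w → ⊥
      last-repeats []       (s≤s ()) _ _
      last-repeats (x ∷ xs) _ (_ ∷ (w∉ ∷ _)) e = All.lookup w∉ (last-∈ w x xs) (sym e)

  cycle-after-link : HasCycle (R ∪ link u v) → HasCycle R ⊎ (Star R u v ⊎ Star R v u)
  cycle-after-link {u = u} (x , ws , long , distinct , walk) with u ∈? (x ∷ ws)
  ... | no u∉ = inj₁ (x , ws , long , distinct , avoid-link _ (not-on-closed-walk u∉) walk)
    where
    not-on-closed-walk : u ∉ (x ∷ ws) → u ∉ (x ∷ ws ++ [ x ])
    not-on-closed-walk u∉ (here e)  = u∉ (here e)
    not-on-closed-walk u∉ (there m) with ∈-++⁻ ws m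
    ... | inj₁ m′       = u∉ (there m′)
    ... | inj₂ (here e) = u∉ (here e)
  ... | yes u∈ with rotate-cycle ws u∈ long distinct walk
  ...   | ws′ , long′ , distinct′ , walk′ = cycle-through ws′ long′ distinct′ walk′

  acyclic-link : Symmetric R → ¬ HasCycle R → ¬ Star R u v → ¬ HasCycle (R ∪ link u v)
  acyclic-link symm acyclic disconnected cycle with cycle-after-link cycle
  ... | inj₁ cycle′       = acyclic cycle′
  ... | inj₂ (inj₁ path) = disconnected path
  ... | inj₂ (inj₂ path) = disconnected (Star.reverse symm path)

open Cycles public

-- Acyclicity of a directed relation after contracting a symmetric one

module Contraction {n : ℕ} where

  private variable
    D D′ K K′ M : FinRel n
    a b u v : Fin n

  BackPath : FinRel n → FinRel n → Set
  BackPath D K = Σ (Fin n) λ x → Σ (Fin n) λ y → D x y × Star (D ∪ K) y x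

  -- D has no directed cycle once the edges of K are contracted.
  AcyclicMod : FinRel n → FinRel n → Set
  AcyclicMod D K = ¬ BackPath D K

  acyclic-mono : D′ ⇒ D → K′ ⇒ K → AcyclicMod D K → AcyclicMod D′ K′
  acyclic-mono f g acyclic (x , y , d , back) = acyclic (x , y , f d , Star.map (⊎-map f g) back)

  backPath? : Decidable₂ D → Decidable₂ K → Dec (BackPath D K)
  backPath? D? K? = any? λ x → any? λ y → D? x y ×-dec star? (λ a b → D? a b ⊎-dec K? a b) y x

  arc-within-class : D a b → Star K b a → ¬ AcyclicMod D K
  arc-within-class d k acyclic = acyclic (_ , _ , d , Star.map inj₂ k)

  path-via-arc : Star (M ∪ arc u v) a b → Star M a b ⊎ (Star M a u × Star M v b)
  path-via-arc ε = inj₁ ε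
  path-via-arc (inj₁ m ◅ s) with path-via-arc s
  ... | inj₁ t        = inj₁ (m ◅ t)
  ... | inj₂ (p , q)  = inj₂ (m ◅ p , q)
  path-via-arc (inj₂ (refl , refl) ◅ s) with path-via-arc s
  ... | inj₁ t        = inj₂ (ε , t)
  ... | inj₂ (_ , q)  = inj₂ (ε , q)

  path-via-link : Star (M ∪ link u v) a b →
                  Star M a b ⊎ ((Star M a u × Star M v b) ⊎ (Star M a v × Star M u b))
  path-via-link ε = inj₁ ε
  path-via-link (inj₁ m ◅ s) with path-via-link s
  ... | inj₁ t               = inj₁ (m ◅ t)
  ... | inj₂ (inj₁ (p , q)) = inj₂ (inj₁ (m ◅ p , q))
  ... | inj₂ (inj₂ (p , q)) = inj₂ (inj₂ (m ◅ p , q))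
  path-via-link (inj₂ (inj₁ (refl , refl)) ◅ s) with path-via-link s
  ... | inj₁ t               = inj₂ (inj₁ (ε , t))
  ... | inj₂ (inj₁ (_ , q)) = inj₂ (inj₁ (ε , q))
  ... | inj₂ (inj₂ (_ , q)) = inj₁ q
  path-via-link (inj₂ (inj₂ (refl , refl)) ◅ s) with path-via-link s
  ... | inj₁ t               = inj₂ (inj₂ (ε , t))
  ... | inj₂ (inj₁ (_ , q)) = inj₁ q
  ... | inj₂ (inj₂ (_ , q)) = inj₂ (inj₂ (ε , q))

  path-first-arc : Star (D ∪ K) a b →
    Star K a b ⊎ Σ (Fin n) λ x → Σ (Fin n) λ y → Star (D ∪ K) a x × D x y × Star (D ∪ K) y b
  path-first-arc ε = inj₁ ε
  path-first-arc (inj₁ d ◅ s) = inj₂ (_ , _ , ε , d , s)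
  path-first-arc (inj₂ k ◅ s) with path-first-arc s
  ... | inj₁ t                   = inj₁ (k ◅ t)
  ... | inj₂ (x , y , p , d , q) = inj₂ (x , y , inj₂ k ◅ p , d , q)

  back-path-via-arc : ∀ {D K : FinRel n} {u v} → BackPath (D ∪ arc u v) K → BackPath D K ⊎ Star (D ∪ K) v u
  back-path-via-arc {D} {K} {u} {v} (x , y , d , back) = cases d (path-via-arc (Star.map regroup back))
    where
    regroup : ((D ∪ arc u v) ∪ K) ⇒ ((D ∪ K) ∪ arc u v)
    regroup (inj₁ (inj₁ d)) = inj₁ (inj₁ d)
    regroup (inj₁ (inj₂ a)) = inj₂ a
    regroup (inj₂ k)        = inj₁ (inj₂ k)
    cases : (D ∪ arc u v) x y → Star (D ∪ K) y x ⊎ (Star (D ∪ K) y u × Star (D ∪ K) v x) →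
            BackPath D K ⊎ Star (D ∪ K) v u
    cases (inj₁ d)             (inj₁ t)       = inj₁ (x , y , d , t)
    cases (inj₁ d)             (inj₂ (p , q)) = inj₂ (q ◅◅ (inj₁ d ◅ p))
    cases (inj₂ (refl , refl)) (inj₁ t)       = inj₂ t
    cases (inj₂ (refl , refl)) (inj₂ (p , _)) = inj₂ p

  acyclic-contract : ∀ {D K : FinRel n} {u v} → AcyclicMod (D ∪ arc u v) K → AcyclicMod (D ∪ arc v u) K →
                     AcyclicMod D (K ∪ link u v)
  acyclic-contract {D} {K} {u} {v} forward backward (x , y , d , back) =
    cases (path-via-link (Star.map regroup back))
    where
    regroup : (D ∪ (K ∪ link u v)) ⇒ ((D ∪ K) ∪ link u v)
    regroup (inj₁ d)        = inj₁ (inj₁ d)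
    regroup (inj₂ (inj₁ k)) = inj₁ (inj₂ k)
    regroup (inj₂ (inj₂ e)) = inj₂ e
    lift : ∀ {a b} → Star (D ∪ K) ⇒ Star ((D ∪ arc a b) ∪ K)
    lift = Star.map (⊎-map inj₁ id)
    cases : Star (D ∪ K) y x ⊎ ((Star (D ∪ K) y u × Star (D ∪ K) v x) ⊎ (Star (D ∪ K) y v × Star (D ∪ K) u x)) → ⊥
    cases (inj₁ t)               = forward (x , y , inj₁ d , lift t)
    cases (inj₂ (inj₁ (p , q))) = forward (x , y , inj₁ d , lift p ◅◅ (inj₁ (inj₂ (refl , refl)) ◅ lift q))
    cases (inj₂ (inj₂ (p , q))) = backward (x , y , inj₁ d , lift p ◅◅ (inj₁ (inj₂ (refl , refl)) ◅ lift q))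

  -- If u and v are not identified by K, at least one orientation of uv can be
  -- added: otherwise the two ways back, v ⇝ u and u ⇝ v, form a cycle.
  acyclic-orient : ∀ {D K : FinRel n} {u v} → Symmetric K → ¬ Star K u v → AcyclicMod D K →
                   ¬ AcyclicMod (D ∪ arc u v) K → AcyclicMod (D ∪ arc v u) K
  acyclic-orient {D} {K} {u} {v} symm apart acyclic not-forward via-vu =
    not-forward λ via-uv → cases (back-path-via-arc via-uv) (back-path-via-arc via-vu)
    where
    cases : BackPath D K ⊎ Star (D ∪ K) v u → BackPath D K ⊎ Star (D ∪ K) u v → ⊥
    cases (inj₁ p) _ = acyclic p
    cases _ (inj₁ p) = acyclic p
    cases (inj₂ vu) (inj₂ uv) with path-first-arc vu
    ... | inj₁ k                   = apart (Star.reverse symm k)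
    ... | inj₂ (x , y , p , d , q) = acyclic (x , y , d , q ◅◅ (uv ◅◅ p))

  acyclic-uncontract : ∀ {D K : FinRel n} {u v} → Symmetric K → ¬ Star K u v → AcyclicMod D (K ∪ link u v) →
                       AcyclicMod (D ∪ arc u v) K
  acyclic-uncontract {D} {K} {u} {v} symm apart acyclic p = cases (back-path-via-arc p)
    where
    widen : (D ∪ K) ⇒ (D ∪ (K ∪ link u v))
    widen = ⊎-map id inj₁
    cases : BackPath D K ⊎ Star (D ∪ K) v u → ⊥
    cases (inj₁ (x , y , d , back)) = acyclic (x , y , d , Star.map widen back)
    cases (inj₂ vu) with path-first-arc vu
    ... | inj₁ k                  = apart (Star.reverse symm k)
    ... | inj₂ (x , y , p , d , q) =
      acyclic (x , y , d , Star.map widen q ◅◅ (inj₂ (inj₂ (inj₁ (refl , refl))) ◅ Star.map widen p))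

  acyclic-uncontract′ : Symmetric K → ¬ Star K u v → AcyclicMod D (K ∪ link u v) →
                        AcyclicMod (D ∪ arc v u) K
  acyclic-uncontract′ symm apart acyclic =
    acyclic-uncontract symm (apart ∘ Star.reverse symm) (acyclic-mono id (⊎-map id swap) acyclic)
    where
    swap : ∀ {u v x y : Fin n} → link v u x y → link u v x y
    swap (inj₁ a) = inj₂ a
    swap (inj₂ a) = inj₁ a

open Contraction public

module EdgeLists {n : ℕ} where
  open import Data.Product.Properties using (≡-dec)
  open import Data.List.Membership.DecPropositional (≡-dec (_≟_ {n}) (_≟_ {n})) using (_∈?_)

  private variable
    S S′ K L σ : List (Edge n)
    u v : Fin n

  SAdj-sym : Symmetric (SAdj S)
  SAdj-sym (inj₁ m) = inj₂ m
  SAdj-sym (inj₂ m) = inj₁ m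

  SAdj-⊆ : (∀ {e} → e ∈ S → e ∈ S′) → SAdj S ⇒ SAdj S′
  SAdj-⊆ f = ⊎-map f f

  SAdj? : ∀ S → Decidable₂ (SAdj S)
  SAdj? S u v = ((u , v) ∈? S) ⊎-dec ((v , u) ∈? S)

  SAdj-∷ : SAdj ((u , v) ∷ K) ⇒ (SAdj K ∪ link u v)
  SAdj-∷ (inj₁ (here refl)) = inj₂ (inj₁ (refl , refl))
  SAdj-∷ (inj₁ (there m))   = inj₁ (inj₁ m)
  SAdj-∷ (inj₂ (here refl)) = inj₂ (inj₂ (refl , refl))
  SAdj-∷ (inj₂ (there m))   = inj₁ (inj₂ m)

  SAdj-∷⁻ : (SAdj K ∪ link u v) ⇒ SAdj ((u , v) ∷ K)
  SAdj-∷⁻ (inj₁ (inj₁ m))             = inj₁ (there m)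
  SAdj-∷⁻ (inj₁ (inj₂ m))             = inj₂ (there m)
  SAdj-∷⁻ (inj₂ (inj₁ (refl , refl))) = inj₁ (here refl)
  SAdj-∷⁻ (inj₂ (inj₂ (refl , refl))) = inj₂ (here refl)

  move-edge : ∀ {e : Edge n} (S K : List (Edge n)) → (e ∷ S) ++ K ↭ S ++ e ∷ K
  move-edge {e} S K = ↭-sym (shift e S K)

  -- The orientation of L in which the edges of σ point forward (i → j) and
  -- all other edges backward; Defs.Arc G O is Orient (edges G) O.
  Orient : List (Edge n) → List (Edge n) → FinRel n
  Orient L σ x y = ((x , y) ∈ L × (x , y) ∈ σ) ⊎ ((y , x) ∈ L × (y , x) ∉ σ)

  orient? : ∀ L σ → Decidable₂ (Orient L σ)
  orient? L σ x y = ((x , y) ∈? L ×-dec (x , y) ∈? σ) ⊎-dec ((y , x) ∈? L ×-dec ¬? ((y , x) ∈? σ))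

  orient-forward : ∀ {u v L σ} → (u , v) ∉ L →
                   Orient ((u , v) ∷ L) ((u , v) ∷ σ) ⇔ (Orient L σ ∪ arc u v)
  orient-forward {u} {v} {L} {σ} new = to , from
    where
    to : Orient ((u , v) ∷ L) ((u , v) ∷ σ) ⇒ (Orient L σ ∪ arc u v)
    to (inj₁ (_ , here refl))       = inj₂ (refl , refl)
    to (inj₁ (here refl , there _)) = inj₂ (refl , refl)
    to (inj₁ (there l , there s))   = inj₁ (inj₁ (l , s))
    to (inj₂ (here refl , ∉σ))      = ⊥-elim (∉σ (here refl))
    to (inj₂ (there l , ∉σ))        = inj₁ (inj₂ (l , ∉σ ∘ there))
    from : (Orient L σ ∪ arc u v) ⇒ Orient ((u , v) ∷ L) ((u , v) ∷ σ)
    from (inj₁ (inj₁ (l , s)))  = inj₁ (there l , there s)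
    from (inj₁ (inj₂ (l , ∉σ))) = inj₂ (there l , λ { (here refl) → new l ; (there s) → ∉σ s })
    from (inj₂ (refl , refl))   = inj₁ (here refl , here refl)

  orient-backward : ∀ {u v L σ} → (u , v) ∉ L → (∀ {e} → e ∈ σ → e ∈ L) →
                    Orient ((u , v) ∷ L) σ ⇔ (Orient L σ ∪ arc v u)
  orient-backward {u} {v} {L} {σ} new σ⊆L = to , from
    where
    to : Orient ((u , v) ∷ L) σ ⇒ (Orient L σ ∪ arc v u)
    to (inj₁ (here refl , s)) = ⊥-elim (new (σ⊆L s))
    to (inj₁ (there l , s))   = inj₁ (inj₁ (l , s))
    to (inj₂ (here refl , _)) = inj₂ (refl , refl)
    to (inj₂ (there l , ∉σ))  = inj₁ (inj₂ (l , ∉σ))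
    from : (Orient L σ ∪ arc v u) ⇒ Orient ((u , v) ∷ L) σ
    from (inj₁ (inj₁ (l , s)))  = inj₁ (there l , s)
    from (inj₁ (inj₂ (l , ∉σ))) = inj₂ (there l , ∉σ)
    from (inj₂ (refl , refl))   = inj₂ (here refl , new ∘ σ⊆L)

open EdgeLists public

-- Counting on a partially contracted graph

Ordered : ∀ {n} → Edge n → Set
Ordered (i , j) = toℕ i < toℕ j

NoParallel : ∀ {n} → List (Edge n) → List (Edge n) → Set
NoParallel K L = All (λ (i , j) → ¬ SAdj K i j) L

-- The counts are taken relative to a decision procedure for forests, which
-- the theorem supplies.
module Counts {n : ℕ} (noCycle? : (S : List (Edge n)) → Dec (¬ HasCycle (SAdj S))) where
  open import Data.Product.Properties using (≡-dec)
  open import Data.List.Membership.DecPropositional (≡-dec (_≟_ {n}) (_≟_ {n})) using (_∈?_)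

  Forest : List (Edge n) → List (Edge n) → Set
  Forest K S = ¬ HasCycle (SAdj (S ++ K))

  AcyclicOrientation : List (Edge n) → List (Edge n) → List (Edge n) → Set
  AcyclicOrientation K L σ = AcyclicMod (Orient L σ) (SAdj K)

  WIForest : List (Edge n) → List (Edge n) → List (Edge n) → Set
  WIForest K L S = Forest K S × All (λ (i , j) → Star (SAdj (S ++ K)) i j → (i , j) ∈ S) L

  forest? : ∀ K → Decidable (Forest K)
  forest? K S = noCycle? (S ++ K)

  acyclicOrientation? : ∀ K L → Decidable (AcyclicOrientation K L)
  acyclicOrientation? K L σ = ¬? (backPath? (orient? L σ) (SAdj? K))

  wiForest? : ∀ K L → Decidable (WIForest K L)
  wiForest? K L S =
    forest? K S ×-dec all? (λ (i , j) → star? (SAdj? (S ++ K)) i j →-dec ((i , j) ∈? S)) L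

  forests orientations wiForests : List (Edge n) → List (Edge n) → ℕ
  forests      K L = count (forest? K) (sublists L)
  orientations K L = count (acyclicOrientation? K L) (sublists L)
  wiForests    K L = count (wiForest? K L) (sublists L)

  forest-move : ∀ {e} K S → Forest K (e ∷ S) → Forest (e ∷ K) S
  forest-move K S acyclic = acyclic ∘ cycle-mono (SAdj-⊆ (∈-resp-↭ (↭-sym (move-edge S K))))

  forest-move⁻ : ∀ {e} K S → Forest (e ∷ K) S → Forest K (e ∷ S)
  forest-move⁻ K S acyclic = acyclic ∘ cycle-mono (SAdj-⊆ (∈-resp-↭ (move-edge S K)))

  forests-∷ : ∀ e K L → forests K (e ∷ L) ≡ forests (e ∷ K) L + forests K L
  forests-∷ e K L = trans (count-sublists-∷ (forest? K) e L)
    (cong (_+ forests K L) (count-cong (λ S → forest? K (e ∷ S)) (forest? (e ∷ K)) (sublists L)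
      (λ S _ → forest-move K S) (λ S _ → forest-move⁻ K S)))

  forest-extend : ∀ {u v} K → Forest K [] → ¬ Star (SAdj K) u v → Forest ((u , v) ∷ K) []
  forest-extend K acyclic apart = acyclic-link SAdj-sym acyclic apart ∘ cycle-mono SAdj-∷

  module FirstEdge {u v : Fin n} {K L : List (Edge n)} (new : (u , v) ∉ L) where

    private
      e : Edge n
      e = (u , v)

      forward : ∀ {σ} → AcyclicOrientation K (e ∷ L) (e ∷ σ) → AcyclicMod (Orient L σ ∪ arc u v) (SAdj K)
      forward = acyclic-mono (proj₂ (orient-forward new)) id

      forward⁻ : ∀ {σ} → AcyclicMod (Orient L σ ∪ arc u v) (SAdj K) → AcyclicOrientation K (e ∷ L) (e ∷ σ)
      forward⁻ = acyclic-mono (proj₁ (orient-forward new)) id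

      backward : ∀ {σ} → σ ∈ sublists L → AcyclicOrientation K (e ∷ L) σ → AcyclicMod (Orient L σ ∪ arc v u) (SAdj K)
      backward σ∈ = acyclic-mono (proj₂ (orient-backward new (sublist-⊆ σ∈))) id

      backward⁻ : ∀ {σ} → σ ∈ sublists L → AcyclicMod (Orient L σ ∪ arc v u) (SAdj K) → AcyclicOrientation K (e ∷ L) σ
      backward⁻ σ∈ = acyclic-mono (proj₁ (orient-backward new (sublist-⊆ σ∈))) id

      contracted : ∀ {σ} → AcyclicOrientation (e ∷ K) L σ → AcyclicMod (Orient L σ) (SAdj K ∪ link u v)
      contracted = acyclic-mono id SAdj-∷⁻

      contracted⁻ : ∀ {σ} → AcyclicMod (Orient L σ) (SAdj K ∪ link u v) → AcyclicOrientation (e ∷ K) L σ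
      contracted⁻ = acyclic-mono id SAdj-∷

      e-forward? : Decidable (λ σ → AcyclicOrientation K (e ∷ L) (e ∷ σ))
      e-forward? σ = acyclicOrientation? K (e ∷ L) (e ∷ σ)

      e-backward? : Decidable (AcyclicOrientation K (e ∷ L))
      e-backward? = acyclicOrientation? K (e ∷ L)

      deleted? : Decidable (AcyclicOrientation K L)
      deleted? = acyclicOrientation? K L

      contracted? : Decidable (AcyclicOrientation (e ∷ K) L)
      contracted? = acyclicOrientation? (e ∷ K) L

    orientations-∷-≤ : orientations K (e ∷ L) ≤ orientations K L + orientations (e ∷ K) L
    orientations-∷-≤ = begin
      orientations K (e ∷ L)
        ≡⟨ count-sublists-∷ e-backward? e L ⟩
      count e-forward? (sublists L) + count e-backward? (sublists L)
        ≤⟨ count-pair-mono e-forward? e-backward? deleted? contracted? (sublists L) (λ σ σ∈ →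
             𝟙-pair-≤ (e-forward? σ) (e-backward? σ) (deleted? σ) (contracted? σ)
               (acyclic-mono inj₁ id ∘ forward)
               (acyclic-mono inj₁ id ∘ backward σ∈)
               (λ p q → contracted⁻ (acyclic-contract (forward p) (backward σ∈ q)))) ⟩
      orientations K L + orientations (e ∷ K) L ∎
      where open ≤-Reasoning

    orientations-∷-≥ : ¬ Star (SAdj K) u v → orientations K L + orientations (e ∷ K) L ≤ orientations K (e ∷ L)
    orientations-∷-≥ apart = begin
      orientations K L + orientations (e ∷ K) L
        ≤⟨ count-pair-mono deleted? contracted? e-forward? e-backward? (sublists L) (λ σ σ∈ →
             𝟙-pair-≥ (e-forward? σ) (e-backward? σ) (deleted? σ) (contracted? σ)
               (λ p ¬forward → backward⁻ σ∈ (acyclic-orient SAdj-sym apart p (¬forward ∘ forward⁻)))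
               (λ q → forward⁻ (acyclic-uncontract SAdj-sym apart (contracted q)))
               (λ q → backward⁻ σ∈ (acyclic-uncontract′ SAdj-sym apart (contracted q)))) ⟩
      count e-forward? (sublists L) + count e-backward? (sublists L)
        ≡⟨ sym (count-sublists-∷ e-backward? e L) ⟩
      orientations K (e ∷ L) ∎
      where open ≤-Reasoning

    -- If K already joins u and v, both orientations of e close a cycle.
    orientations-loop : Star (SAdj K) u v → orientations K (e ∷ L) ≡ 0
    orientations-loop joined = trans (count-sublists-∷ e-backward? e L) (cong₂ _+_
      (count-none _ (sublists L) (λ σ _ → arc-within-class (inj₁ (here refl , here refl)) (Star.reverse SAdj-sym joined)))
      (count-none _ (sublists L) (λ σ σ∈ → arc-within-class (inj₂ (here refl , new ∘ sublist-⊆ σ∈)) joined)))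

    wiForests-∷-≤ : wiForests K (e ∷ L) ≤ wiForests (e ∷ K) L + wiForests K L
    wiForests-∷-≤ = begin
      wiForests K (e ∷ L)
        ≡⟨ count-sublists-∷ (wiForest? K (e ∷ L)) e L ⟩
      count (λ S → wiForest? K (e ∷ L) (e ∷ S)) (sublists L) + count (wiForest? K (e ∷ L)) (sublists L)
        ≤⟨ +-mono-≤ (count-mono _ _ (sublists L) (λ S _ → contract S))
                    (count-mono _ _ (sublists L) (λ S _ (forest , closed) → forest , All.tail closed)) ⟩
      wiForests (e ∷ K) L + wiForests K L ∎
      where
      open ≤-Reasoning
      contract : ∀ S → WIForest K (e ∷ L) (e ∷ S) → WIForest (e ∷ K) L S
      contract S (forest , closed) =
        forest-move K S forest ,
        All.tabulate λ {f} f∈L path →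
          drop-e f∈L (All.lookup (All.tail closed) f∈L (Star.map (SAdj-⊆ (∈-resp-↭ (↭-sym (move-edge S K)))) path))
        where
        drop-e : ∀ {f} → f ∈ L → f ∈ e ∷ S → f ∈ S
        drop-e f∈L (here refl) = ⊥-elim (new f∈L)
        drop-e f∈L (there f∈S) = f∈S

    -- If K already joins u and v, then S ∪ K contains a cycle when e ∈ S, and
    -- violates the closure condition at e when e ∉ S.
    wiForests-loop : Ordered e → ¬ SAdj K u v → Star (SAdj K) u v → wiForests K (e ∷ L) ≡ 0
    wiForests-loop ordered not-adjacent joined = trans (count-sublists-∷ (wiForest? K (e ∷ L)) e L) (cong₂ _+_
      (count-none _ (sublists L) (λ S _ (forest , _) → forest (cycle S)))
      (count-none _ (sublists L) (λ S S∈ (_ , closed) →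
        new (sublist-⊆ S∈ (All.head closed (Star.map (SAdj-⊆ (∈-++⁺ʳ S)) joined))))))
      where
      cycle : ∀ S → HasCycle (SAdj ((e ∷ S) ++ K))
      cycle S with simple-path joined
      ... | ε , _                 = ⊥-elim (<-irrefl refl ordered)
      ... | (r ◅ ε) , _           = ⊥-elim (not-adjacent r)
      ... | t@(_ ◅ _ ◅ _) , simple =
        simple-path-cycle (SAdj-⊆ (∈-++⁺ʳ (e ∷ S))) t simple (s≤s (s≤s z≤n)) (inj₂ (here refl))

  open FirstEdge

  noParallel-∷ : ∀ {u v : Fin n} {K L : List (Edge n)} → (u , v) ∉ L → Ordered (u , v) → All Ordered L →
                 NoParallel K ((u , v) ∷ L) → NoParallel ((u , v) ∷ K) L
  noParallel-∷ {u} {v} {K} {L} new ordered all-ordered (_ ∷ apart) =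
    All.tabulate λ {f} f∈L → still-apart f f∈L (All.lookup all-ordered f∈L) (All.lookup apart f∈L)
    where
    still-apart : ∀ f → f ∈ L → Ordered f → ¬ SAdj K (proj₁ f) (proj₂ f) → ¬ SAdj ((u , v) ∷ K) (proj₁ f) (proj₂ f)
    still-apart f f∈L _         _   (inj₁ (here refl)) = new f∈L
    still-apart f f∈L _         old (inj₁ (there m))   = old (inj₁ m)
    still-apart f f∈L f-ordered _   (inj₂ (here refl)) = <-asym f-ordered ordered
    still-apart f f∈L _         old (inj₂ (there m))   = old (inj₂ m)

  orientations≤forests : ∀ L K → Unique L → Forest K [] → orientations K L ≤ forests K L
  orientations≤forests [] K _ acyclic =
    count-mono (acyclicOrientation? K []) (forest? K) (sublists []) λ { _ (here refl) _ → acyclic }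
  orientations≤forests (e@(u , v) ∷ L) K distinct@(_ ∷ distinct′) acyclic
    with star? (SAdj? K) u v | Unique[x∷xs]⇒x∉xs distinct
  ... | yes joined | new = ≤-trans (≤-reflexive (orientations-loop new joined)) z≤n
  ... | no apart   | new = begin
    orientations K (e ∷ L)                    ≤⟨ orientations-∷-≤ new ⟩
    orientations K L + orientations (e ∷ K) L ≤⟨ +-mono-≤ (orientations≤forests L K distinct′ acyclic)
                                                          (orientations≤forests L (e ∷ K) distinct′ (forest-extend K acyclic apart)) ⟩
    forests K L + forests (e ∷ K) L           ≡⟨ +-comm (forests K L) _ ⟩
    forests (e ∷ K) L + forests K L           ≡⟨ sym (forests-∷ e K L) ⟩
    forests K (e ∷ L)                         ∎
    where open ≤-Reasoning

  wiForests≤orientations : ∀ L K → Unique L → All Ordered L → NoParallel K L → wiForests K L ≤ orientations K L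
  wiForests≤orientations [] K _ _ _ =
    count-mono (wiForest? K []) (acyclicOrientation? K []) (sublists []) λ { _ (here refl) _ → no-arcs }
    where
    no-arcs : AcyclicOrientation K [] []
    no-arcs (_ , _ , inj₁ (() , _) , _)
    no-arcs (_ , _ , inj₂ (() , _) , _)
  wiForests≤orientations (e@(u , v) ∷ L) K distinct@(_ ∷ distinct′) (ordered ∷ all-ordered) apart-all
    with star? (SAdj? K) u v | Unique[x∷xs]⇒x∉xs distinct
  ... | yes joined | new = ≤-trans (≤-reflexive (wiForests-loop new ordered (All.head apart-all) joined)) z≤n
  ... | no apart   | new = begin
    wiForests K (e ∷ L)                       ≤⟨ wiForests-∷-≤ new ⟩
    wiForests (e ∷ K) L + wiForests K L       ≤⟨ +-mono-≤ (wiForests≤orientations L (e ∷ K) distinct′ all-ordered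
                                                             (noParallel-∷ new ordered all-ordered apart-all))
                                                          (wiForests≤orientations L K distinct′ all-ordered (All.tail apart-all)) ⟩
    orientations (e ∷ K) L + orientations K L ≡⟨ +-comm (orientations (e ∷ K) L) _ ⟩
    orientations K L + orientations (e ∷ K) L ≤⟨ orientations-∷-≥ new apart ⟩
    orientations K (e ∷ L)                    ∎
    where open ≤-Reasoning

unique-concatMap : (f : A → List B) (key : B → A) (xs : List A) → Unique xs →
                   (∀ x → Unique (f x)) → (∀ x b → b ∈ f x → key b ≡ x) → Unique (concatMap f xs)
unique-concatMap f key []       _              _        _      = []
unique-concatMap f key (x ∷ xs) (x∉ ∷ distinct) blocks keyed =
  ++⁺ (blocks x) (unique-concatMap f key xs distinct blocks keyed) disjoint
  where
  disjoint : ∀ {b} → ¬ (b ∈ f x × b ∈ concatMap f xs)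
  disjoint {b} (b∈fx , b∈rest) with find (∈-concatMap⁻ f {xs = xs} b∈rest)
  ... | x′ , x′∈xs , b∈fx′ =
    Unique[x∷xs]⇒x∉xs (x∉ ∷ distinct) (subst (_∈ xs) (trans (sym (keyed x′ b b∈fx′)) (keyed x b b∈fx)) x′∈xs)

module EdgesOf {n : ℕ} (G : SimpleGraph n) where

  candidate : Fin n → Fin n → List (Edge n)
  candidate i j = if ⌊ i <? j ⌋ ∧ adj G i j then [ (i , j) ] else []

  candidate-unique : ∀ i j → Unique (candidate i j)
  candidate-unique i j with i <? j | adj G i j
  ... | yes _ | true  = [] ∷ []
  ... | yes _ | false = []
  ... | no _  | _     = []

  candidate-∈ : ∀ i j {e} → e ∈ candidate i j → e ≡ (i , j) × Ordered (i , j)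
  candidate-∈ i j e∈ with i <? j | adj G i j
  candidate-∈ i j (here refl) | yes i<j | true = refl , i<j

  row-∈ : ∀ i {e} → e ∈ concatMap (candidate i) (allFin n) → Σ (Fin n) λ j → e ∈ candidate i j
  row-∈ i e∈ with find (∈-concatMap⁻ (candidate i) {xs = allFin n} e∈)
  ... | j , _ , e∈ij = j , e∈ij

  edges-∈ : ∀ {e} → e ∈ edges G → Σ (Fin n) λ i → Σ (Fin n) λ j → e ∈ candidate i j
  edges-∈ e∈ with find (∈-concatMap⁻ (λ i → concatMap (candidate i) (allFin n)) {xs = allFin n} e∈)
  ... | i , _ , e∈i = i , row-∈ i e∈i

  edges-unique : Unique (edges G)
  edges-unique = unique-concatMap (λ i → concatMap (candidate i) (allFin n)) proj₁ (allFin n) (allFin⁺ n)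
    (λ i → unique-concatMap (candidate i) proj₂ (allFin n) (allFin⁺ n) (candidate-unique i)
             (λ j e e∈ → cong proj₂ (proj₁ (candidate-∈ i j e∈))))
    (λ i e e∈ → let (j , e∈ij) = row-∈ i e∈ in cong proj₁ (proj₁ (candidate-∈ i j e∈ij)))

  edges-ordered : All Ordered (edges G)
  edges-ordered = All.tabulate λ e∈ →
    let (i , j , e∈ij) = edges-∈ e∈
        (e≡ij , ordered) = candidate-∈ i j e∈ij
    in subst Ordered (sym e≡ij) ordered

open EdgesOf using (edges-unique; edges-ordered)

no-cycle-[] : ∀ {n} → ¬ HasCycle (SAdj {n} [])
no-cycle-[] (_ , [] , () , _)
no-cycle-[] (_ , _ ∷ _ , _ , _ , inj₁ () ∷ _)
no-cycle-[] (_ , _ ∷ _ , _ , _ , inj₂ () ∷ _)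

no-parallel-[] : ∀ {n} (L : List (Edge n)) → NoParallel [] L
no-parallel-[] L = All.tabulate λ _ → λ { (inj₁ ()) ; (inj₂ ()) }

module Uncontracted {n : ℕ} (G : SimpleGraph n) (dF : Decidable (IsForest G)) where
  open Counts dF

  private
    drop-[] : ∀ {S : List (Edge n)} {e} → e ∈ S ++ [] → e ∈ S
    drop-[] {S} {e} = subst (e ∈_) (++-identityʳ S)

  forest-of : ∀ S → Forest [] S → IsForest G S
  forest-of S acyclic = acyclic ∘ cycle-mono (SAdj-⊆ ∈-++⁺ˡ)

  wiForest-of : ∀ S → IsWIForest G S → WIForest [] (edges G) S
  wiForest-of S (acyclic , closed) =
    acyclic ∘ cycle-mono (SAdj-⊆ drop-[]) ,
    All.tabulate λ e∈ path → closed _ _ e∈ (Star.map (SAdj-⊆ drop-[]) path)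

  -- A closed directed walk is the same as an arc with a directed way back.
  acyclic-of : ∀ O → AcyclicOrientation [] (edges G) O → IsAcyclicOrientation G O
  acyclic-of O acyclic (v , []     , r ∷ [-])  = acyclic (v , v , r , ε)
  acyclic-of O acyclic (v , w ∷ ws , r ∷ walk) = acyclic (v , w , r , Star.map inj₁ (walk→path ws walk))

  acyclic-to : ∀ O → IsAcyclicOrientation G O → AcyclicOrientation [] (edges G) O
  acyclic-to O acyclic (x , y , d , back) = acyclic (x , vertices back′ , path→walk id back′ d)
    where
    only-arcs : (Orient (edges G) O ∪ SAdj []) ⇒ Orient (edges G) O
    only-arcs (inj₁ a)        = a
    only-arcs (inj₂ (inj₁ ()))
    only-arcs (inj₂ (inj₂ ()))
    back′ : Star (Orient (edges G) O) y x
    back′ = Star.map only-arcs back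

lemma3p3 : ∀ {n} (G : SimpleGraph n)
    (dW : Decidable (IsWIForest G))
    (dA : Decidable (IsAcyclicOrientation G))
    (dF : Decidable (IsForest G)) →
    numWIForests G dW ≤ numAcyclicOrientations G dA
      × numAcyclicOrientations G dA ≤ numForests G dF
lemma3p3 {n} G dW dA dF = wi≤a , a≤F
  where
  open Counts dF
  open Uncontracted G dF
  open ≤-Reasoning
  E : List (Edge n)
  E = edges G

  wi≤a : numWIForests G dW ≤ numAcyclicOrientations G dA
  wi≤a = begin
    numWIForests G dW           ≤⟨ count-mono dW (wiForest? [] E) (sublists E) (λ S _ → wiForest-of S) ⟩
    wiForests [] E              ≤⟨ wiForests≤orientations E [] (edges-unique G) (edges-ordered G) (no-parallel-[] E) ⟩
    orientations [] E           ≤⟨ count-mono (acyclicOrientation? [] E) dA (sublists E) (λ O _ → acyclic-of O) ⟩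
    numAcyclicOrientations G dA ∎

  a≤F : numAcyclicOrientations G dA ≤ numForests G dF
  a≤F = begin
    numAcyclicOrientations G dA ≤⟨ count-mono dA (acyclicOrientation? [] E) (sublists E) (λ O _ → acyclic-to O) ⟩
    orientations [] E           ≤⟨ orientations≤forests E [] (edges-unique G) no-cycle-[] ⟩
    forests [] E                ≤⟨ count-mono (forest? []) dF (sublists E) (λ S _ → forest-of S) ⟩
    numForests G dF             ∎
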